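{- Let $k\ge1$, $n\ge k+2$, and let $(d_{i,j})$ be the frieze associated with an equation in $\mathcal{E}_{k+1,n}$ with coefficients $a_i^j$. Then the North-East diagonals $\mu_i=(d_{i,j})_j$ satisfy the projectively dual difference equation: for all $i,j$ for which the entries involved are defined, $d_{i,j}=a_{i-2}^kd_{i-1,j}-a_{i-3}^{k-1}d_{i-2,j}+\cdots+(-1)^{k-1}a_{i-k-1}^1d_{i-k,j}+(-1)^kd_{i-k-1,j}$; equivalently $\mu'_i:=\mu_{i+k+1}$ satisfies $\mu'_i=a^k_{i+k-1}\mu'_{i-1}-a^{k-1}_{i+k-2}\mu'_{i-2}+\cdots+(-1)^{k-1}a^1_i\mu'_{i-k}+(-1)^k\mu'_{i-k-1}$.
   Context: $\mathcal{E}_{k+1,n}$ is the set of difference equations $V_i=a_i^1V_{i-1}-a_i^2V_{i-2}+\cdots+(-1)^{k-1}a_i^kV_{i-k}+(-1)^kV_{i-k-1}$ with real $n$-periodic coefficients such that every solution satisfies $V_{i+n}=(-1)^kV_i$. With $w=n-k-2$, the frieze associated with such an equation is the array $d_{i,j}:=V_j$ ($i\in\mathbb{Z}$, $i-k-1\le j\le i+w+k$), where $(V_s)$ is the solution with $V_{i-k-1}=\dots=V_{i-2}=0$, $V_{i-1}=1$. -}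

module Defs where

open import Level using (Level)
open import Algebra.Bundles using (CommutativeRing)
open import Data.Nat using (ℕ; zero; suc)
import Data.Nat as N
open import Data.Integer using (ℤ; +_) renaming (_-_ to _-ℤ_; _+_ to _+ℤ_; _≤_ to _≤ℤ_)
open import Data.Product using (_×_)

module _ {c ℓ : Level} (R : CommutativeRing c ℓ) where
  open CommutativeRing R using (_≈_; 0#; 1#) renaming (Carrier to A; _+_ to _⊕_; _*_ to _⊛_; -_ to ⊖_)

  sgn : ℕ → A
  sgn zero = 1#
  sgn (suc m) = ⊖ sgn m

  sumFrom1 : ℕ → (ℕ → A) → A
  sumFrom1 zero f = 0#
  sumFrom1 (suc m) f = sumFrom1 m f ⊕ f (suc m)

  -- Coefficients: a m i stands for a_i^m (only 1 ≤ m ≤ k is used).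
  -- V solves  V_i = a_i^1 V_{i-1} - a_i^2 V_{i-2} + ... + (-1)^{k-1} a_i^k V_{i-k} + (-1)^k V_{i-k-1}
  IsSolution : (k : ℕ) → (ℕ → ℤ → A) → (ℤ → A) → Set ℓ
  IsSolution k a V = ∀ (i : ℤ) →
    V i ≈ (sumFrom1 k (λ m → sgn (m N.∸ 1) ⊛ (a m i ⊛ V (i -ℤ + m)))
            ⊕ (sgn k ⊛ V (i -ℤ + (suc k))))

  Periodic : (k n : ℕ) → (ℕ → ℤ → A) → Set ℓ
  Periodic k n a = ∀ (m : ℕ) → 1 N.≤ m → m N.≤ k → ∀ (i : ℤ) → a m (i +ℤ + n) ≈ a m i

  -- The equation with coefficients a lies in E_{k+1,n}: real(ring)-valued n-periodic
  -- coefficients and every solution satisfies V_{i+n} = (-1)^k V_i.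
  InE : (k n : ℕ) → (ℕ → ℤ → A) → Set (c Level.⊔ ℓ)
  InE k n a = Periodic k n a × (∀ (V : ℤ → A) → IsSolution k a V → ∀ (i : ℤ) → V (i +ℤ + n) ≈ sgn k ⊛ V i)

  InitialWindow : (k : ℕ) → (i : ℤ) → (ℤ → A) → Set ℓ
  InitialWindow k i S = (∀ (t : ℕ) → 2 N.≤ t → t N.≤ suc k → S (i -ℤ + t) ≈ 0#) × (S (i -ℤ + 1) ≈ 1#)

  -- d is the frieze of the equation: d i = (d_{i,j})_j is the solution with the initial window at i.
  IsFrieze : (k : ℕ) → (ℕ → ℤ → A) → (ℤ → ℤ → A) → Set ℓ
  IsFrieze k a d = ∀ (i : ℤ) → IsSolution k a (d i) × InitialWindow k i (d i)

Defined : (k n : ℕ) → ℤ → ℤ → Set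
Defined k n i j = (i -ℤ + (suc k) ≤ℤ j) × (j ≤ℤ (i +ℤ + (n N.∸ (k N.+ 2))) +ℤ + k)

-- Write L f = f − step f, where step f t is the right-hand side of the recurrence at t.
-- Truncating the fundamental solution d_r (the r-th row of the frieze) to 0 below its
-- initial window gives a Green's function: L h_r = δ_{r−1}.  By linearity, L applied to
-- h_i − dualStep h i is a combination of deltas at i−k−2, …, i−1, and reversing the order
-- of summation (m ↦ k+1−m, which turns a^m into the dual coefficient a^{k+1−m}) shows that
-- it equals −(−1)^k L δ_{i−k−2}.  Hence g = h_i − dualStep h i + (−1)^k δ_{i−k−2} solves the
-- homogeneous recurrence and vanishes below i−k−2, so it vanishes everywhere.  For
-- j ≥ i−k−1 the truncations agree with the rows and the delta term is 0, which is the dual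
-- recurrence.

module Submission where

open import Defs
open import Level using (Level)
open import Algebra.Bundles using (CommutativeRing)
open import Data.Nat using (ℕ; zero; suc; _∸_; _≤_; _<_; z≤n; s≤s) renaming (_+_ to _+ℕ_)
import Data.Nat.Properties as ℕ
open import Data.Integer using (ℤ; +_; ∣_∣; pred; +≤+)
  renaming ( suc to sucℤ; -_ to negate; _-_ to _-ℤ_; _+_ to _+ℤ_
           ; _≤_ to _≤ℤ_; _<_ to _<ℤ_; _≟_ to _≟ℤ_; _≤?_ to _≤?ℤ_)
import Data.Integer.Properties as ℤ
open import Data.Integer.Tactic.RingSolver using (solve-∀)
open import Data.Bool using (if_then_else_)
open import Data.Product using (_,_; proj₁; proj₂)
open import Data.Sum using (inj₁; inj₂)
open import Relation.Binary.Definitions using (tri<; tri≈; tri>)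
open import Relation.Binary.PropositionalEquality as ≡ using (_≡_; _≢_)
open import Relation.Nullary using (contradiction; does; yes; no)

i-m<i : ∀ i {m} → 1 ≤ m → i -ℤ + m <ℤ i
i-m<i i {suc m} _ =
  ℤ.i≤pred[j]⇒i<j (ℤ.≤-trans (ℤ.≤-reflexive (ℤ.minus-suc i m)) (ℤ.pred-mono (ℤ.i-j≤i i (+ m))))

i-n≤i-m : ∀ i {m n} → m ≤ n → i -ℤ + n ≤ℤ i -ℤ + m
i-n≤i-m i m≤n = ℤ.+-monoʳ-≤ i (ℤ.neg-mono-≤ (+≤+ m≤n))

i-m≤i-n⇒n≤m : ∀ i {m n} → i -ℤ + m ≤ℤ i -ℤ + n → n ≤ m
i-m≤i-n⇒n≤m i {m} {n} le = ℤ.drop‿+≤+ (ℤ.neg-cancel-≤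
  (≡.subst₂ _≤ℤ_ (-i+[i-j]≡-j i (+ m)) (-i+[i-j]≡-j i (+ n)) (ℤ.+-monoʳ-≤ (negate i) le)))
  where
    -i+[i-j]≡-j : ∀ i j → negate i +ℤ (i -ℤ j) ≡ negate j
    -i+[i-j]≡-j = solve-∀

i+[1+n]≡suc[i+n] : ∀ i n → i +ℤ + suc n ≡ sucℤ (i +ℤ + n)
i+[1+n]≡suc[i+n] i n = ≡.trans (≡.cong (i +ℤ_) (ℤ.pos-+ 1 n)) (i+[1+j]≡1+[i+j] i (+ n))
  where
    i+[1+j]≡1+[i+j] : ∀ i j → i +ℤ (+ 1 +ℤ j) ≡ + 1 +ℤ (i +ℤ j)
    i+[1+j]≡1+[i+j] = solve-∀

≤⇒<+[1+n] : ∀ {t} x n → t ≤ℤ x +ℤ + n → t <ℤ x +ℤ + suc n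
≤⇒<+[1+n] x n t≤ =
  ℤ.suc[i]≤j⇒i<j (ℤ.≤-trans (ℤ.suc-mono t≤) (ℤ.≤-reflexive (≡.sym (i+[1+n]≡suc[i+n] x n))))

<+[1+n]⇒≤ : ∀ {t} x n → t <ℤ x +ℤ + suc n → t ≤ℤ x +ℤ + n
<+[1+n]⇒≤ x n t< = ℤ.≤-trans (ℤ.i<j⇒i≤pred[j] t<)
  (ℤ.≤-reflexive (≡.trans (≡.cong pred (i+[1+n]≡suc[i+n] x n)) (ℤ.pred-suc _)))

i≤j+∣j-i∣ : ∀ i j → i ≤ℤ j +ℤ + ∣ j -ℤ i ∣
i≤j+∣j-i∣ i j with ℤ.≤-total i j
... | inj₁ i≤j = ℤ.≤-trans i≤j (ℤ.i≤i+j j (+ ∣ j -ℤ i ∣))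
... | inj₂ j≤i = ℤ.≤-reflexive (≡.trans (i≡j+[i-j] i j) (≡.cong (j +ℤ_) (≡.sym (ℤ.∣-∣-≤ j≤i))))
  where
    i≡j+[i-j] : ∀ i j → i ≡ j +ℤ (i -ℤ j)
    i≡j+[i-j] = solve-∀

1+[i-1]≡i : ∀ i → + 1 +ℤ (i -ℤ + 1) ≡ i
1+[i-1]≡i = solve-∀

<-1⇒≡-[2+n] : ∀ {t r} → t <ℤ r -ℤ + 1 → t ≡ r -ℤ + (2 +ℕ ∣ t -ℤ (r -ℤ + 2) ∣)
<-1⇒≡-[2+n] {t} {r} t<r-1 =
  ≡.trans (t≡r-[2+[r-2-t]] t r) (≡.cong (λ j → r -ℤ (+ 2 +ℤ j)) (≡.sym (ℤ.∣-∣-≤ t≤r-2)))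
  where
    t≤r-2 : t ≤ℤ r -ℤ + 2
    t≤r-2 = ℤ.≤-trans (ℤ.i<j⇒i≤pred[j] t<r-1) (ℤ.≤-reflexive (≡.sym (ℤ.minus-suc r 1)))
    t≡r-[2+[r-2-t]] : ∀ t r → t ≡ r -ℤ (+ 2 +ℤ ((r -ℤ + 2) -ℤ t))
    t≡r-[2+[r-2-t]] = solve-∀

i-[1+m]≡i-m-1 : ∀ i m → i -ℤ + suc m ≡ (i -ℤ + m) -ℤ + 1
i-[1+m]≡i-m-1 i m = ≡.trans (ℤ.minus-suc i m) (-1+j≡j-1 (i -ℤ + m))
  where
    -1+j≡j-1 : ∀ j → negate (+ 1) +ℤ j ≡ j -ℤ + 1
    -1+j≡j-1 = solve-∀

t-[k∸m]-[i-k-2]≡t-[i-m-2] : ∀ t i {k m} → m < k →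
  (t -ℤ + (k ∸ m)) -ℤ ((i -ℤ + suc k) -ℤ + 1) ≡ t -ℤ (i -ℤ + suc (suc m))
t-[k∸m]-[i-k-2]≡t-[i-m-2] t i {k} {m} m<k = begin
  (t -ℤ + (k ∸ m)) -ℤ ((i -ℤ + suc k) -ℤ + 1)
    ≡⟨ ≡.cong₂ (λ u v → (t -ℤ u) -ℤ ((i -ℤ v) -ℤ + 1)) k-m (ℤ.pos-+ 1 k) ⟩
  (t -ℤ (+ k -ℤ + m)) -ℤ ((i -ℤ (+ 1 +ℤ + k)) -ℤ + 1)
    ≡⟨ ring-identity t i (+ k) (+ m) ⟩
  t -ℤ (i -ℤ (+ 2 +ℤ + m))
    ≡⟨ ≡.cong (λ u → t -ℤ (i -ℤ u)) (ℤ.pos-+ 2 m) ⟨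
  t -ℤ (i -ℤ + suc (suc m))
    ∎
  where
    open ≡.≡-Reasoning
    k-m : + (k ∸ m) ≡ + k -ℤ + m
    k-m = ≡.sym (≡.trans (ℤ.[+m]-[+n]≡m⊖n k m) (ℤ.≤-⊖ (ℕ.<⇒≤ m<k)))
    ring-identity : ∀ t i K M → (t -ℤ (K -ℤ M)) -ℤ ((i -ℤ (+ 1 +ℤ K)) -ℤ + 1) ≡ t -ℤ (i -ℤ (+ 2 +ℤ M))
    ring-identity = solve-∀

module _ {c ℓ : Level} (R : CommutativeRing c ℓ) where

  open CommutativeRing R renaming (Carrier to A)
  open import Algebra.Properties.Ring ring using (-1*x≈-x; -‿distribˡ-*; -‿distribʳ-*; -‿involutive)
  open import Algebra.Properties.CommutativeSemigroup +-commutativeSemigroup using (interchange)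
  open import Algebra.Properties.CommutativeSemigroup *-commutativeSemigroup using (x∙yz≈y∙xz)
  open import Algebra.Properties.AbelianGroup +-abelianGroup using (xyx⁻¹≈y; ⁻¹-∙-comm)
  open import Algebra.Properties.Group +-group using (x≈y⇒x∙y⁻¹≈ε; x∙y⁻¹≈ε⇒x≈y)
  open import Relation.Binary.Reasoning.Setoid setoid

  private
    Σ : ℕ → (ℕ → A) → A
    Σ = sumFrom1 R

    σ : ℕ → A
    σ = sgn R

  Σ-cong : ∀ n {f g : ℕ → A} → (∀ m → 1 ≤ m → m ≤ n → f m ≈ g m) → Σ n f ≈ Σ n g
  Σ-cong zero    f≈g = refl
  Σ-cong (suc n) f≈g =
    +-cong (Σ-cong n (λ m 1≤m m≤n → f≈g m 1≤m (ℕ.m≤n⇒m≤1+n m≤n))) (f≈g (suc n) (s≤s z≤n) ℕ.≤-refl)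

  Σ-≈0 : ∀ n {f : ℕ → A} → (∀ m → 1 ≤ m → m ≤ n → f m ≈ 0#) → Σ n f ≈ 0#
  Σ-≈0 zero    f≈0 = refl
  Σ-≈0 (suc n) f≈0 = begin
    Σ n _ + _  ≈⟨ +-cong (Σ-≈0 n (λ m 1≤m m≤n → f≈0 m 1≤m (ℕ.m≤n⇒m≤1+n m≤n)))
                         (f≈0 (suc n) (s≤s z≤n) ℕ.≤-refl) ⟩
    0# + 0#    ≈⟨ +-identityˡ 0# ⟩
    0#         ∎

  Σ-+ : ∀ n (f g : ℕ → A) → Σ n (λ m → f m + g m) ≈ Σ n f + Σ n g
  Σ-+ zero    f g = sym (+-identityˡ 0#)
  Σ-+ (suc n) f g = trans (+-congʳ (Σ-+ n f g)) (interchange _ _ _ _)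

  Σ-*ˡ : ∀ n x (f : ℕ → A) → Σ n (λ m → x * f m) ≈ x * Σ n f
  Σ-*ˡ zero    x f = sym (zeroʳ x)
  Σ-*ˡ (suc n) x f = trans (+-congʳ (Σ-*ˡ n x f)) (sym (distribˡ x _ _))

  Σ-unfoldˡ : ∀ n (f : ℕ → A) → Σ (suc n) f ≈ f 1 + Σ n (λ m → f (suc m))
  Σ-unfoldˡ zero    f = trans (+-identityˡ _) (sym (+-identityʳ _))
  Σ-unfoldˡ (suc n) f = trans (+-congʳ (Σ-unfoldˡ n f)) (+-assoc _ _ _)

  Σ-reverse : ∀ n (f : ℕ → A) → Σ n f ≈ Σ n (λ m → f (suc n ∸ m))
  Σ-reverse zero    f = refl
  Σ-reverse (suc n) f = begin
    Σ n f + f (suc n)                      ≈⟨ +-congʳ (Σ-reverse n f) ⟩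
    Σ n (λ m → f (suc n ∸ m)) + f (suc n)  ≈⟨ +-comm _ _ ⟩
    f (suc n) + Σ n (λ m → f (suc n ∸ m))  ≈⟨ Σ-unfoldˡ n (λ m → f (suc (suc n) ∸ m)) ⟨
    Σ (suc n) (λ m → f (suc (suc n) ∸ m))  ∎

  σ-+ : ∀ m n → σ (m +ℕ n) ≈ σ m * σ n
  σ-+ zero    n = sym (*-identityˡ _)
  σ-+ (suc m) n = trans (-‿cong (σ-+ m n)) (-‿distribˡ-* _ _)

  σ-square : ∀ n → σ n * σ n ≈ 1#
  σ-square zero    = *-identityˡ 1#
  σ-square (suc n) = begin
    - σ n * - σ n    ≈⟨ -‿distribˡ-* _ _ ⟨
    - (σ n * - σ n)  ≈⟨ -‿cong (-‿distribʳ-* _ _) ⟨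
    - - (σ n * σ n)  ≈⟨ -‿involutive _ ⟩
    σ n * σ n        ≈⟨ σ-square n ⟩
    1#               ∎

  σ-complement : ∀ {m n} → m ≤ n → σ n * σ (n ∸ m) ≈ σ m
  σ-complement {m} {n} m≤n = begin
    σ n * σ p          ≈⟨ *-congʳ (reflexive (≡.cong σ (≡.sym (ℕ.m+[n∸m]≡n m≤n)))) ⟩
    σ (m +ℕ p) * σ p   ≈⟨ *-congʳ (σ-+ m p) ⟩
    (σ m * σ p) * σ p  ≈⟨ *-assoc _ _ _ ⟩
    σ m * (σ p * σ p)  ≈⟨ *-congˡ (σ-square p) ⟩
    σ m * 1#           ≈⟨ *-identityʳ _ ⟩
    σ m                ∎
    where
      p : ℕ
      p = n ∸ m

  σ-reflect : ∀ {k m} → m < k → σ k * σ ((k ∸ m) ∸ 1) ≈ - σ m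
  σ-reflect {k} {m} m<k = begin
    σ k * σ ((k ∸ m) ∸ 1)  ≈⟨ *-congˡ (reflexive (≡.cong σ k∸m∸1≡k∸[1+m])) ⟩
    σ k * σ (k ∸ suc m)    ≈⟨ σ-complement m<k ⟩
    - σ m                  ∎
    where
      k∸m∸1≡k∸[1+m] : (k ∸ m) ∸ 1 ≡ k ∸ suc m
      k∸m∸1≡k∸[1+m] = ≡.trans (ℕ.∸-+-assoc k m 1) (≡.cong (k ∸_) (ℕ.+-comm m 1))

  y+sv≈x+su⇒[x-y]+s[u-v]≈0 : ∀ {x y u v} s → y + s * v ≈ x + s * u → (x - y) + s * (u - v) ≈ 0#
  y+sv≈x+su⇒[x-y]+s[u-v]≈0 {x} {y} {u} {v} s eq = begin
    (x - y) + s * (u - v)            ≈⟨ +-congˡ (trans (distribˡ s u (- v)) (+-congˡ (sym (-‿distribʳ-* s v)))) ⟩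
    (x - y) + (s * u - s * v)        ≈⟨ interchange _ _ _ _ ⟩
    (x + s * u) + (- y + - (s * v))  ≈⟨ +-congˡ (⁻¹-∙-comm y (s * v)) ⟩
    (x + s * u) - (y + s * v)        ≈⟨ x≈y⇒x∙y⁻¹≈ε (sym eq) ⟩
    0#                               ∎

  δ : ℤ → ℤ → A
  δ t x = if does (t ≟ℤ x) then 1# else 0#

  δ-refl : ∀ t → δ t t ≈ 1#
  δ-refl t with t ≟ℤ t
  ... | yes _   = refl
  ... | no t≢t = contradiction ≡.refl t≢t

  δ-≢ : ∀ {t x} → t ≢ x → δ t x ≈ 0#
  δ-≢ {t} {x} t≢x with t ≟ℤ x
  ... | yes t≡x = contradiction t≡x t≢x
  ... | no _    = refl

  δ-translate : ∀ t x t′ x′ → t -ℤ x ≡ t′ -ℤ x′ → δ t x ≡ δ t′ x′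
  δ-translate t x t′ x′ eq with t ≟ℤ x | t′ ≟ℤ x′
  ... | yes _      | yes _      = ≡.refl
  ... | no _       | no _       = ≡.refl
  ... | yes ≡.refl | no t′≢x′   =
    contradiction (ℤ.i-j≡0⇒i≡j t′ x′ (≡.trans (≡.sym eq) (ℤ.+-inverseʳ t))) t′≢x′
  ... | no t≢x     | yes ≡.refl =
    contradiction (ℤ.i-j≡0⇒i≡j t x (≡.trans eq (ℤ.+-inverseʳ t′))) t≢x

  *-δ : ∀ (f : ℤ → A) t x → f t * δ t x ≈ f x * δ t x
  *-δ f t x with t ≟ℤ x
  ... | yes ≡.refl = refl
  ... | no _       = trans (zeroʳ _) (sym (zeroʳ _))

  truncateBelow : ℤ → (ℤ → A) → ℤ → A
  truncateBelow x V t = if does (x ≤?ℤ t) then V t else 0#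

  truncateBelow-≥ : ∀ {x t} (V : ℤ → A) → x ≤ℤ t → truncateBelow x V t ≈ V t
  truncateBelow-≥ {x} {t} V x≤t with x ≤?ℤ t
  ... | yes _   = refl
  ... | no x≰t = contradiction x≤t x≰t

  module Recurrence (k : ℕ) (a : ℕ → ℤ → A) where

    step : (ℤ → A) → ℤ → A
    step f t = Σ k (λ m → σ (m ∸ 1) * (a m t * f (t -ℤ + m))) + σ k * f (t -ℤ + suc k)

    step-cong : ∀ t {f g : ℤ → A} → (∀ m → 1 ≤ m → m ≤ suc k → f (t -ℤ + m) ≈ g (t -ℤ + m)) →
                step f t ≈ step g t
    step-cong t f≈g =
      +-cong (Σ-cong k (λ m 1≤m m≤k → *-congˡ (*-congˡ (f≈g m 1≤m (ℕ.m≤n⇒m≤1+n m≤k)))))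
             (*-congˡ (f≈g (suc k) (s≤s z≤n) ℕ.≤-refl))

    step-≈0 : ∀ t {f : ℤ → A} → (∀ m → 1 ≤ m → m ≤ suc k → f (t -ℤ + m) ≈ 0#) → step f t ≈ 0#
    step-≈0 t {f} f≈0 = begin
      step f t           ≈⟨ step-cong t {f} f≈0 ⟩
      step (λ _ → 0#) t  ≈⟨ +-cong (Σ-≈0 k (λ _ _ _ → trans (*-congˡ (zeroʳ _)) (zeroʳ _))) (zeroʳ _) ⟩
      0# + 0#            ≈⟨ +-identityˡ 0# ⟩
      0#                 ∎

    step-+ : ∀ t (f g : ℤ → A) → step (λ s → f s + g s) t ≈ step f t + step g t
    step-+ t f g = trans
      (+-cong (trans (Σ-cong k (λ _ _ _ → trans (*-congˡ (distribˡ _ _ _)) (distribˡ _ _ _))) (Σ-+ k _ _))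
              (distribˡ _ _ _))
      (interchange _ _ _ _)

    step-*ˡ : ∀ t x (f : ℤ → A) → step (λ s → x * f s) t ≈ x * step f t
    step-*ˡ t x f = trans
      (+-cong (trans (Σ-cong k (λ _ _ _ → trans (*-congˡ (x∙yz≈y∙xz _ _ _)) (x∙yz≈y∙xz _ _ _))) (Σ-*ˡ k x _))
              (x∙yz≈y∙xz _ _ _))
      (sym (distribˡ x _ _))

    IsSolutionWith : (ℤ → A) → (ℤ → A) → Set ℓ
    IsSolutionWith f ε = ∀ t → f t ≈ step f t + ε t

    IsSolutionWith-cong : ∀ {f f′ ε ε′ : ℤ → A} → (∀ t → f t ≈ f′ t) → (∀ t → ε t ≈ ε′ t) →
                          IsSolutionWith f ε → IsSolutionWith f′ ε′
    IsSolutionWith-cong {f} {f′} f≈f′ ε≈ε′ f-sol t = begin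
      f′ t           ≈⟨ f≈f′ t ⟨
      f t            ≈⟨ f-sol t ⟩
      step f t + _   ≈⟨ +-cong (step-cong t {f} {f′} (λ _ _ _ → f≈f′ _)) (ε≈ε′ t) ⟩
      step f′ t + _  ∎

    IsSolutionWith-+ : ∀ {f g ε η : ℤ → A} → IsSolutionWith f ε → IsSolutionWith g η →
                       IsSolutionWith (λ t → f t + g t) (λ t → ε t + η t)
    IsSolutionWith-+ {f} {g} {ε} {η} f-sol g-sol t = begin
      f t + g t                               ≈⟨ +-cong (f-sol t) (g-sol t) ⟩
      (step f t + ε t) + (step g t + η t)     ≈⟨ interchange _ _ _ _ ⟩
      (step f t + step g t) + (ε t + η t)     ≈⟨ +-congʳ (step-+ t f g) ⟨
      step (λ s → f s + g s) t + (ε t + η t)  ∎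

    IsSolutionWith-*ˡ : ∀ x {f ε : ℤ → A} → IsSolutionWith f ε →
                        IsSolutionWith (λ t → x * f t) (λ t → x * ε t)
    IsSolutionWith-*ˡ x {f} {ε} f-sol t = begin
      x * f t                           ≈⟨ *-congˡ (f-sol t) ⟩
      x * (step f t + ε t)              ≈⟨ distribˡ x _ _ ⟩
      x * step f t + x * ε t            ≈⟨ +-congʳ (step-*ˡ t x f) ⟨
      step (λ s → x * f s) t + x * ε t  ∎

    IsSolutionWith-neg : ∀ {f ε : ℤ → A} → IsSolutionWith f ε →
                         IsSolutionWith (λ t → - f t) (λ t → - ε t)
    IsSolutionWith-neg f-sol =
      IsSolutionWith-cong (λ _ → -1*x≈-x _) (λ _ → -1*x≈-x _) (IsSolutionWith-*ˡ (- 1#) f-sol)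

    IsSolutionWith-Σ : ∀ n {F E : ℕ → ℤ → A} → (∀ q → IsSolutionWith (F q) (E q)) →
                       IsSolutionWith (λ t → Σ n (λ q → F q t)) (λ t → Σ n (λ q → E q t))
    IsSolutionWith-Σ zero    sols t = sym (trans (+-identityʳ _) (step-≈0 t (λ _ _ _ → refl)))
    IsSolutionWith-Σ (suc n) sols = IsSolutionWith-+ (IsSolutionWith-Σ n sols) (sols (suc n))

    IsSolutionWith-residual : ∀ f → IsSolutionWith f (λ t → f t - step f t)
    IsSolutionWith-residual f t = begin
      f t                          ≈⟨ xyx⁻¹≈y (step f t) (f t) ⟨
      (step f t + f t) - step f t  ≈⟨ +-assoc _ _ _ ⟩
      step f t + (f t - step f t)  ∎

    IsSolutionWith⇒IsSolution : ∀ {f ε : ℤ → A} → (∀ t → ε t ≈ 0#) → IsSolutionWith f ε →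
                                IsSolution R k a f
    IsSolutionWith⇒IsSolution ε≈0 f-sol t = trans (f-sol t) (trans (+-congˡ (ε≈0 t)) (+-identityʳ _))

    IsSolution-vanishing-below : ∀ {g : ℤ → A} → IsSolution R k a g →
                                 ∀ x → (∀ t → t <ℤ x → g t ≈ 0#) → ∀ t → g t ≈ 0#
    IsSolution-vanishing-below {g} g-sol x below t =
      below+ (suc ∣ x -ℤ t ∣) t (≤⇒<+[1+n] x _ (i≤j+∣j-i∣ t x))
      where
        below+ : ∀ n t → t <ℤ x +ℤ + n → g t ≈ 0#
        below+ zero    t t<x = below t (≡.subst (t <ℤ_) (ℤ.+-identityʳ x) t<x)
        below+ (suc n) t t<  with ℤ.<-cmp t (x +ℤ + n)
        ... | tri< t<x+n _ _  = below+ n t t<x+n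
        ... | tri≈ _ ≡.refl _ = trans (g-sol t) (step-≈0 t {g} (λ m 1≤m _ → below+ n _ (i-m<i t 1≤m)))
        ... | tri> _ _ x+n<t  = contradiction (<+[1+n]⇒≤ x n t<) (ℤ.<⇒≱ x+n<t)

    -- Truncated fundamental solutions

    InitialWindow-vanishes : ∀ {r t} {V : ℤ → A} → InitialWindow R k r V →
                             r -ℤ + suc k ≤ℤ t → t <ℤ r -ℤ + 1 → V t ≈ 0#
    InitialWindow-vanishes {r} {t} {V} (zeros , _) r-k-1≤t t<r-1 =
      trans (reflexive (≡.cong V t≡r-s)) (zeros s (s≤s (s≤s z≤n)) s≤1+k)
      where
        s : ℕ
        s = 2 +ℕ ∣ t -ℤ (r -ℤ + 2) ∣
        t≡r-s : t ≡ r -ℤ + s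
        t≡r-s = ≡.trans (<-1⇒≡-[2+n] {r = r} t<r-1) (≡.cong (λ j → r -ℤ j) (ℤ.pos-+ 2 _))
        s≤1+k : s ≤ suc k
        s≤1+k = i-m≤i-n⇒n≤m r (ℤ.≤-trans r-k-1≤t (ℤ.≤-reflexive t≡r-s))

    truncate : ℤ → (ℤ → A) → ℤ → A
    truncate r V = truncateBelow (r -ℤ + suc k) V

    truncate-vanishes : ∀ {r t} {V : ℤ → A} → InitialWindow R k r V → t <ℤ r -ℤ + 1 →
                        truncate r V t ≈ 0#
    truncate-vanishes {r} {t} {V} w t<r-1 with (r -ℤ + suc k) ≤?ℤ t
    ... | yes r-k-1≤t = InitialWindow-vanishes {r} {V = V} w r-k-1≤t t<r-1
    ... | no _         = refl

    truncate-IsSolutionWith : ∀ {r} {V : ℤ → A} → IsSolution R k a V → InitialWindow R k r V →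
                              IsSolutionWith (truncate r V) (λ t → δ t (r -ℤ + 1))
    truncate-IsSolutionWith {r} {V} V-sol w t with ℤ.<-cmp t (r -ℤ + 1)
    ... | tri< t<r-1 _ _ = begin
      truncate r V t                          ≈⟨ truncate-vanishes {r} {V = V} w t<r-1 ⟩
      0#                                      ≈⟨ +-identityˡ 0# ⟨
      0# + 0#                                 ≈⟨ +-cong (sym (step-≈0 t {truncate r V} below))
                                                        (sym (δ-≢ (ℤ.<⇒≢ t<r-1))) ⟩
      step (truncate r V) t + δ t (r -ℤ + 1)  ∎
      where
        below : ∀ m → 1 ≤ m → m ≤ suc k → truncate r V (t -ℤ + m) ≈ 0#
        below m 1≤m _ = truncate-vanishes {r} {V = V} w (ℤ.<-trans (i-m<i t 1≤m) t<r-1)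
    ... | tri≈ _ ≡.refl _ = begin
      truncate r V t                          ≈⟨ truncateBelow-≥ V (i-n≤i-m r (s≤s z≤n)) ⟩
      V t                                     ≈⟨ proj₂ w ⟩
      1#                                      ≈⟨ +-identityˡ 1# ⟨
      0# + 1#                                 ≈⟨ +-cong (sym (step-≈0 t {truncate r V} below)) (sym (δ-refl t)) ⟩
      step (truncate r V) t + δ t t           ∎
      where
        below : ∀ m → 1 ≤ m → m ≤ suc k → truncate r V (t -ℤ + m) ≈ 0#
        below m 1≤m _ = truncate-vanishes {r} {V = V} w (i-m<i t 1≤m)
    ... | tri> _ _ r-1<t = begin
      truncate r V t                          ≈⟨ truncateBelow-≥ V (ℤ.≤-trans (i-n≤i-m r (s≤s z≤n)) (ℤ.<⇒≤ r-1<t)) ⟩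
      V t                                     ≈⟨ V-sol t ⟩
      step V t                                ≈⟨ step-cong t {V} {truncate r V} above ⟩
      step (truncate r V) t                   ≈⟨ +-identityʳ _ ⟨
      step (truncate r V) t + 0#              ≈⟨ +-congˡ (sym (δ-≢ (λ t≡r-1 → ℤ.<⇒≢ r-1<t (≡.sym t≡r-1)))) ⟩
      step (truncate r V) t + δ t (r -ℤ + 1)  ∎
      where
        r≤t : r ≤ℤ t
        r≤t = ℤ.≤-trans (ℤ.≤-reflexive (≡.sym (1+[i-1]≡i r))) (ℤ.i<j⇒suc[i]≤j r-1<t)
        above : ∀ m → 1 ≤ m → m ≤ suc k → V (t -ℤ + m) ≈ truncate r V (t -ℤ + m)
        above m _ m≤1+k =
          sym (truncateBelow-≥ V (ℤ.≤-trans (i-n≤i-m r m≤1+k) (ℤ.+-monoˡ-≤ (negate (+ m)) r≤t)))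

    -- The dual recurrence

    dualStep : (ℤ → ℤ → A) → ℤ → ℤ → A
    dualStep e i j = Σ k (λ m → σ (m ∸ 1) * (a (suc k ∸ m) (i -ℤ + suc m) * e (i -ℤ + m) j))
                     + σ k * e (i -ℤ + suc k) j

    dualStep-cong : ∀ {e e′ : ℤ → ℤ → A} i j → (∀ m → m ≤ suc k → e (i -ℤ + m) j ≈ e′ (i -ℤ + m) j) →
                    dualStep e i j ≈ dualStep e′ i j
    dualStep-cong i j e≈e′ =
      +-cong (Σ-cong k (λ m _ m≤k → *-congˡ (*-congˡ (e≈e′ m (ℕ.m≤n⇒m≤1+n m≤k)))))
             (*-congˡ (e≈e′ (suc k) ℕ.≤-refl))

    dualStep-≈0 : ∀ {e : ℤ → ℤ → A} i j → (∀ m → m ≤ suc k → e (i -ℤ + m) j ≈ 0#) → dualStep e i j ≈ 0#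
    dualStep-≈0 {e} i j e≈0 = begin
      dualStep e i j             ≈⟨ dualStep-cong {e} {λ _ _ → 0#} i j e≈0 ⟩
      dualStep (λ _ _ → 0#) i j  ≈⟨ +-cong (Σ-≈0 k (λ _ _ _ → trans (*-congˡ (zeroʳ _)) (zeroʳ _))) (zeroʳ _) ⟩
      0# + 0#                    ≈⟨ +-identityˡ 0# ⟩
      0#                         ∎

    dualStep-IsSolutionWith : ∀ {e ε : ℤ → ℤ → A} i → (∀ r → IsSolutionWith (e r) (ε r)) →
                              IsSolutionWith (dualStep e i) (dualStep ε i)
    dualStep-IsSolutionWith i sols =
      IsSolutionWith-+ (IsSolutionWith-Σ k (λ m → IsSolutionWith-*ˡ _ (IsSolutionWith-*ˡ _ (sols (i -ℤ + m)))))
                       (IsSolutionWith-*ˡ (σ k) (sols (i -ℤ + suc k)))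

    module _ (i t : ℤ) where

      private
        i-k-2 : ℤ
        i-k-2 = (i -ℤ + suc k) -ℤ + 1

      dual-coefficients :
        Σ k (λ m → σ (m ∸ 1) * (a (suc k ∸ m) (i -ℤ + suc m) * δ t ((i -ℤ + m) -ℤ + 1)))
        + σ k * Σ k (λ m → σ (m ∸ 1) * (a m t * δ (t -ℤ + m) i-k-2)) ≈ 0#
      dual-coefficients = begin
        Σ k D + σ k * Σ k S                      ≈⟨ +-congˡ (Σ-*ˡ k (σ k) S) ⟨
        Σ k D + Σ k (λ m → σ k * S m)            ≈⟨ +-congˡ (Σ-reverse k (λ m → σ k * S m)) ⟩
        Σ k D + Σ k (λ m → σ k * S (suc k ∸ m))  ≈⟨ Σ-+ k D (λ m → σ k * S (suc k ∸ m)) ⟨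
        Σ k (λ m → D m + σ k * S (suc k ∸ m))    ≈⟨ Σ-≈0 k cancel ⟩
        0#                                       ∎
        where
          D S : ℕ → A
          D m = σ (m ∸ 1) * (a (suc k ∸ m) (i -ℤ + suc m) * δ t ((i -ℤ + m) -ℤ + 1))
          S m = σ (m ∸ 1) * (a m t * δ (t -ℤ + m) i-k-2)
          cancel : ∀ m → 1 ≤ m → m ≤ k → D m + σ k * S (suc k ∸ m) ≈ 0#
          cancel (suc m) _ m<k = begin
            D (suc m) + σ k * S (k ∸ m)                    ≈⟨ +-cong D≈ σS≈ ⟩
            σ m * (b x * δ t x) + - σ m * (b x * δ t x)    ≈⟨ +-congˡ (-‿distribˡ-* _ _) ⟨
            σ m * (b x * δ t x) + - (σ m * (b x * δ t x))  ≈⟨ -‿inverseʳ _ ⟩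
            0#                                             ∎
            where
              b : ℤ → A
              b = a (k ∸ m)
              x : ℤ
              x = i -ℤ + suc (suc m)
              D≈ : D (suc m) ≈ σ m * (b x * δ t x)
              D≈ = *-congˡ (*-congˡ (reflexive
                     (δ-translate t _ t x (≡.cong (t -ℤ_) (≡.sym (i-[1+m]≡i-m-1 i (suc m)))))))
              σS≈ : σ k * S (k ∸ m) ≈ - σ m * (b x * δ t x)
              σS≈ = begin
                σ k * (σ ((k ∸ m) ∸ 1) * (b t * δ (t -ℤ + (k ∸ m)) i-k-2))
                  ≈⟨ *-assoc _ _ _ ⟨
                (σ k * σ ((k ∸ m) ∸ 1)) * (b t * δ (t -ℤ + (k ∸ m)) i-k-2)
                  ≈⟨ *-cong (σ-reflect m<k) (*-congˡ (reflexive (δ-translate (t -ℤ + (k ∸ m)) i-k-2 t x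
                                                                   (t-[k∸m]-[i-k-2]≡t-[i-m-2] t i m<k)))) ⟩
                - σ m * (b t * δ t x)
                  ≈⟨ *-congˡ (*-δ b t x) ⟩
                - σ m * (b x * δ t x)
                  ∎

      dualStep-δ : dualStep (λ r s → δ s (r -ℤ + 1)) i t + σ k * step (λ s → δ s i-k-2) t
                   ≈ δ t (i -ℤ + 1) + σ k * δ t i-k-2
      dualStep-δ = begin
        (ΣD + σ k * δ t i-k-2) + σ k * (ΣS + σ k * Z)           ≈⟨ +-congˡ (distribˡ (σ k) _ _) ⟩
        (ΣD + σ k * δ t i-k-2) + (σ k * ΣS + σ k * (σ k * Z))  ≈⟨ interchange _ _ _ _ ⟩
        (ΣD + σ k * ΣS) + (σ k * δ t i-k-2 + σ k * (σ k * Z))  ≈⟨ +-cong dual-coefficients (+-congˡ σ²Z) ⟩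
        0# + (σ k * δ t i-k-2 + δ t (i -ℤ + 1))                 ≈⟨ trans (+-identityˡ _) (+-comm _ _) ⟩
        δ t (i -ℤ + 1) + σ k * δ t i-k-2                        ∎
        where
          ΣD ΣS Z : A
          ΣD = Σ k (λ m → σ (m ∸ 1) * (a (suc k ∸ m) (i -ℤ + suc m) * δ t ((i -ℤ + m) -ℤ + 1)))
          ΣS = Σ k (λ m → σ (m ∸ 1) * (a m t * δ (t -ℤ + m) i-k-2))
          Z = δ (t -ℤ + suc k) i-k-2
          [t-K]-[i-K-1]≡t-[i-1] : ∀ t i K → (t -ℤ K) -ℤ ((i -ℤ K) -ℤ + 1) ≡ t -ℤ (i -ℤ + 1)
          [t-K]-[i-K-1]≡t-[i-1] = solve-∀
          σ²Z : σ k * (σ k * Z) ≈ δ t (i -ℤ + 1)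
          σ²Z = begin
            σ k * (σ k * Z)      ≈⟨ *-assoc _ _ _ ⟨
            (σ k * σ k) * Z      ≈⟨ *-cong (σ-square k) (reflexive (δ-translate (t -ℤ + suc k) i-k-2 t (i -ℤ + 1)
                                                            ([t-K]-[i-K-1]≡t-[i-1] t i (+ suc k)))) ⟩
            1# * δ t (i -ℤ + 1)  ≈⟨ *-identityˡ _ ⟩
            δ t (i -ℤ + 1)       ∎

    module _ {d : ℤ → ℤ → A} (frieze : IsFrieze R k a d) (i : ℤ) where

      private
        h : ℤ → ℤ → A
        h r = truncate r (d r)

        i-k-2 : ℤ
        i-k-2 = (i -ℤ + suc k) -ℤ + 1

        g : ℤ → A
        g t = (h i t - dualStep h i t) + σ k * δ t i-k-2

        g-IsSolution : IsSolution R k a g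
        g-IsSolution = IsSolutionWith⇒IsSolution (λ t → y+sv≈x+su⇒[x-y]+s[u-v]≈0 (σ k) (dualStep-δ i t))
          (IsSolutionWith-+ (IsSolutionWith-+ (row i) (IsSolutionWith-neg (dualStep-IsSolutionWith i row)))
                            (IsSolutionWith-*ˡ (σ k) (IsSolutionWith-residual (λ s → δ s i-k-2))))
          where
            row : ∀ r → IsSolutionWith (h r) (λ t → δ t (r -ℤ + 1))
            row r = truncate-IsSolutionWith {r} (proj₁ (frieze r)) (proj₂ (frieze r))

        h-vanishes : ∀ {r t} → i -ℤ + suc k ≤ℤ r → t <ℤ i-k-2 → h r t ≈ 0#
        h-vanishes {r} r≥i-k-1 t<i-k-2 = truncate-vanishes {r} {V = d r} (proj₂ (frieze r))
          (ℤ.<-≤-trans t<i-k-2 (ℤ.+-monoˡ-≤ _ r≥i-k-1))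

        g-vanishes-below : ∀ t → t <ℤ i-k-2 → g t ≈ 0#
        g-vanishes-below t t<i-k-2 = begin
          (h i t - dualStep h i t) + σ k * δ t i-k-2
            ≈⟨ +-cong (+-cong hᵢ≈0 (-‿cong dualStep≈0)) (*-congˡ (δ-≢ (ℤ.<⇒≢ t<i-k-2))) ⟩
          (0# - 0#) + σ k * 0#  ≈⟨ +-cong (-‿inverseʳ 0#) (zeroʳ _) ⟩
          0# + 0#               ≈⟨ +-identityˡ 0# ⟩
          0#                    ∎
          where
            hᵢ≈0 : h i t ≈ 0#
            hᵢ≈0 = h-vanishes (ℤ.i-j≤i i (+ suc k)) t<i-k-2
            dualStep≈0 : dualStep h i t ≈ 0#
            dualStep≈0 = dualStep-≈0 {h} i t (λ m m≤1+k → h-vanishes (i-n≤i-m i m≤1+k) t<i-k-2)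

      dual-recurrence : ∀ j → i -ℤ + suc k ≤ℤ j → d i j ≈ dualStep d i j
      dual-recurrence j i-k-1≤j = x∙y⁻¹≈ε⇒x≈y _ _ (begin
        d i j - dualStep d i j         ≈⟨ +-cong (sym (h≈d ℤ.≤-refl)) (-‿cong (dualStep-cong {d} {h} i j
                                                   (λ m _ → sym (h≈d (ℤ.i-j≤i i (+ m)))))) ⟩
        h i j - dualStep h i j         ≈⟨ +-identityʳ _ ⟨
        (h i j - dualStep h i j) + 0#  ≈⟨ +-congˡ (trans (*-congˡ (δ-≢ j≢i-k-2)) (zeroʳ _)) ⟨
        g j                            ≈⟨ IsSolution-vanishing-below g-IsSolution i-k-2 g-vanishes-below j ⟩
        0#                             ∎)
        where
          h≈d : ∀ {r} → r ≤ℤ i → h r j ≈ d r j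
          h≈d {r} r≤i = truncateBelow-≥ (d r) (ℤ.≤-trans (ℤ.+-monoˡ-≤ _ r≤i) i-k-1≤j)
          j≢i-k-2 : j ≢ i-k-2
          j≢i-k-2 j≡i-k-2 =
            ℤ.<⇒≢ (ℤ.<-≤-trans (i-m<i (i -ℤ + suc k) (s≤s z≤n)) i-k-1≤j) (≡.sym j≡i-k-2)

proposition5p4 : ∀ {c ℓ : Level} (R : CommutativeRing c ℓ) → let open CommutativeRing R in
    ∀ (k n : ℕ) → 1 ≤ k → suc (suc k) ≤ n →
    ∀ (a : ℕ → ℤ → Carrier) → InE R k n a →
    ∀ (d : ℤ → ℤ → Carrier) → IsFrieze R k a d →
    ∀ (i j : ℤ) → (∀ (m : ℕ) → m ≤ suc k → Defined k n (i -ℤ + m) j) →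
    d i j ≈ (sumFrom1 R k (λ m → sgn R (m ∸ 1) * (a (suc k ∸ m) (i -ℤ + (suc m)) * d (i -ℤ + m) j))
    + (sgn R k * d (i -ℤ + (suc k)) j))
proposition5p4 R k n _ _ a _ d frieze i j defined =
  Recurrence.dual-recurrence R k a frieze i j i-k-1≤j
  where
    i-k-1≤j : i -ℤ + suc k ≤ℤ j
    i-k-1≤j = ≡.subst (λ x → x -ℤ + suc k ≤ℤ j) (ℤ.+-identityʳ i) (proj₁ (defined 0 z≤n))
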